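{- Let $G$ be a unicyclic graph on $n$ vertices with $\operatorname{Z}(\overline{G})=n-4$. Then $G$ contains the cycle $C_4$ as an induced subgraph.
   Context: All graphs are finite, simple and undirected. A unicyclic graph is a connected graph containing exactly one cycle. $\overline{G}$ denotes the complement of $G$ (same vertex set; distinct vertices adjacent iff not adjacent in $G$). Zero forcing: given an initial set $B\subseteq V(G)$ of blue vertices (all others white), a blue vertex with exactly one white neighbor may turn that neighbor blue; $B$ is a zero forcing set if repeated application makes all vertices blue. $\operatorname{Z}(G)$ is the minimum size of a zero forcing set of $G$. -}

module Defs where

open import Data.Nat using (ℕ; zero; suc; _≤_; _<?_)
open import Data.Fin using (Fin; zero; suc; toℕ; fromℕ<; _≟_)
open import Data.Bool using (Bool; true; false; _∨_)
open import Data.Vec using (Vec; lookup)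
open import Data.Fin.Subset using (Subset; ∣_∣)
open import Data.Product using (Σ; ∃; _×_; _,_)
open import Data.Sum using (_⊎_)
open import Relation.Nullary using (¬_; yes; no)
open import Relation.Nullary.Decidable using (isYes)
open import Relation.Binary.PropositionalEquality using (_≡_; _≢_)
open import Relation.Binary.Construct.Closure.ReflexiveTransitive using (Star)
open import Function.Bundles using (_⇔_)

record Graph (n : ℕ) : Set₁ where
  field
    Adj   : Fin n → Fin n → Set
    sym   : ∀ {u v} → Adj u v → Adj v u
    irrefl : ∀ {u} → ¬ Adj u u
open Graph public

complement : ∀ {n} → Graph n → Graph n
complement G = record
  { Adj = λ u v → (u ≢ v) × ¬ Adj G u v
  ; sym = λ { (u≢v , ¬a) → (λ e → u≢v (symm e)) , (λ a → ¬a (Graph.sym G a)) }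
  ; irrefl = λ { (u≢u , _) → u≢u Relation.Binary.PropositionalEquality.refl }
  }
  where symm = Relation.Binary.PropositionalEquality.sym

Connected : ∀ {n} → Graph n → Set
Connected G = ∀ u v → Star (Adj G) u v

next : ∀ {k} → Fin (suc k) → Fin (suc k)
next {k} i with suc (toℕ i) <? suc k
... | yes p = fromℕ< p
... | no _ = zero

-- A cycle of length m+3 in G: distinct vertices c 0, …, c (m+2) with
-- c i adjacent to c (i+1 mod (m+3)).
record Cycle {n : ℕ} (G : Graph n) : Set where
  field
    m     : ℕ
    c     : Fin (suc (suc (suc m))) → Fin n
    inj   : ∀ i j → c i ≡ c j → i ≡ j
    adj   : ∀ i → Adj G (c i) (c (next i))
open Cycle public

CycleEdge : ∀ {n} {G : Graph n} → Cycle G → Fin n → Fin n → Set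
CycleEdge C u v = ∃ λ i → (c C i ≡ u × c C (next i) ≡ v) ⊎ (c C i ≡ v × c C (next i) ≡ u)

SameCycle : ∀ {n} {G : Graph n} → Cycle G → Cycle G → Set
SameCycle C D = ∀ u v → CycleEdge C u v ⇔ CycleEdge D u v

Unicyclic : ∀ {n} → Graph n → Set
Unicyclic G = Connected G × Cycle G × (∀ (C D : Cycle G) → SameCycle C D)

-- Zero forcing. A colouring is a Subset n (true = blue).
-- One force: blue v whose unique white neighbour is w turns w blue.
Force : ∀ {n} → Graph n → Subset n → Subset n → Set
Force G B B' = ∃ λ v → ∃ λ w →
    lookup B v ≡ true × Adj G v w × lookup B w ≡ false
  × (∀ u → Adj G v u → u ≢ w → lookup B u ≡ true)
  × (∀ u → lookup B' u ≡ (lookup B u ∨ isYes (u ≟ w)))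

AllBlue : ∀ {n} → Subset n → Set
AllBlue B = ∀ u → lookup B u ≡ true

IsZeroForcingSet : ∀ {n} → Graph n → Subset n → Set
IsZeroForcingSet G B = ∃ λ F → Star (Force G) B F × AllBlue F

ZeroForcingNumber : ∀ {n} → Graph n → ℕ → Set
ZeroForcingNumber G k =
    (∃ λ B → IsZeroForcingSet G B × ∣ B ∣ ≡ k)
  × (∀ B → IsZeroForcingSet G B → k ≤ ∣ B ∣)

HasInducedC4 : ∀ {n} → Graph n → Set
HasInducedC4 {n} G = Σ (Fin n) λ a → Σ (Fin n) λ b → Σ (Fin n) λ c' → Σ (Fin n) λ d →
    a ≢ b × a ≢ c' × a ≢ d × b ≢ c' × b ≢ d × c' ≢ d
  × Adj G a b × Adj G b c' × Adj G c' d × Adj G d a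
  × ¬ Adj G a c' × ¬ Adj G b d

-- Start from a zero forcing set B of the complement with four white vertices and look at the
-- first two forces, v ⟶ w and then u ⟶ w′.  A force of the complement means that the forcing
-- vertex is adjacent in G to every other white vertex.  So v is G-adjacent to the three
-- vertices still white after the first force, u to the two vertices a, b still white after
-- the second, and u ≠ v because v is G-adjacent to w′ while u is not.  Hence u a v b is a
-- 4-cycle of G.  As G has only one cycle, that cycle has length four, and a chord would create
-- a triangle, i.e. a second cycle; so the 4-cycle is induced.
module Submission where

open import Defs hiding (sym)
open import Data.Nat using (ℕ; _∸_; suc; _+_; _≤_; _<_; s≤s)
open import Data.Nat.Properties as ℕ
  using (≤-antisym; ≤-reflexive; ≮⇒≥; <⇒≤; m≤n⇒m∸n≡0; m+[n∸m]≡n; m≤n+m)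
open import Data.Fin using (Fin; zero; suc; _≟_; inject₁)
open import Data.Fin.Properties using (pigeonhole; <⇒≢; inject₁-injective; suc-injective)
open import Data.Fin.Subset using (Subset; ∣_∣)
open import Data.Bool using (true; false; _∨_)
open import Data.Bool.Properties using (∨-zeroʳ; ∨-identityʳ)
open import Data.Vec using (Vec; []; _∷_; lookup; _[_]≔_)
open import Data.Vec.Properties using (tabulate∘lookup; tabulate-cong; lookup∘update; lookup∘update′)
open import Data.Vec.Relation.Unary.All using ([]; _∷_)
open import Data.Vec.Relation.Unary.AllPairs using ([]; _∷_)
open import Data.Vec.Relation.Unary.Unique.Propositional using (Unique)
open import Data.Vec.Relation.Unary.Unique.Propositional.Properties using (lookup-injective)
open import Data.Product using (Σ; ∃; ∃₂; _×_; _,_; proj₁; proj₂)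
open import Data.Sum using (inj₁; inj₂)
open import Function using (_∘_)
open import Function.Bundles using (Equivalence)
import Function.Properties.Equivalence as ⇔
open import Relation.Nullary using (¬_; yes; no; contradiction)
open import Relation.Nullary.Decidable using (isYes; decidable-stable)
open import Relation.Nullary.Negation using (¬¬-map; ¬¬-Monad)
open import Relation.Binary.PropositionalEquality using (_≡_; _≢_; refl; sym; trans; cong; subst)
open import Relation.Binary.Construct.Closure.ReflexiveTransitive using (ε; _◅_)
open import Effect.Monad using (RawMonad)

private
  variable
    n : ℕ

lookup-ext : ∀ {a} {A : Set a} {xs ys : Vec A n} → (∀ i → lookup xs i ≡ lookup ys i) → xs ≡ ys
lookup-ext {xs = xs} {ys} eq =
  trans (sym (tabulate∘lookup xs)) (trans (tabulate-cong eq) (tabulate∘lookup ys))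

blue≢white : ∀ (p : Subset n) {x y} → lookup p x ≡ true → lookup p y ≡ false → x ≢ y
blue≢white p x-blue y-white refl with trans (sym x-blue) y-white
... | ()

∃-white : ∀ (p : Subset n) → ∣ p ∣ < n → ∃ λ x → lookup p x ≡ false
∃-white (false ∷ p) _ = zero , refl
∃-white (true ∷ p) (s≤s ∣p∣<n) with ∃-white p ∣p∣<n
... | x , x-white = suc x , x-white

∃₂-white : ∀ (p : Subset n) → 2 + ∣ p ∣ ≤ n →
  ∃₂ λ x y → x ≢ y × lookup p x ≡ false × lookup p y ≡ false
∃₂-white (false ∷ p) (s≤s ∣p∣<n) with ∃-white p ∣p∣<n
... | y , y-white = zero , suc y , (λ ()) , refl , y-white
∃₂-white (true ∷ p) (s≤s 2+∣p∣≤n) with ∃₂-white p 2+∣p∣≤n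
... | x , y , x≢y , x-white , y-white = suc x , suc y , x≢y ∘ suc-injective , x-white , y-white

¬allBlue : ∀ (p : Subset n) → ∣ p ∣ < n → ¬ AllBlue p
¬allBlue p ∣p∣<n all-blue with ∃-white p ∣p∣<n
... | x , x-white = blue≢white p (all-blue x) x-white refl

blue⇒∣p∣≢0 : ∀ {p : Subset n} {x} → lookup p x ≡ true → ∣ p ∣ ≢ 0
blue⇒∣p∣≢0 {p = true ∷ p} {zero} _ ()
blue⇒∣p∣≢0 {p = true ∷ p} {suc x} _ ()
blue⇒∣p∣≢0 {p = false ∷ p} {suc x} x-blue = blue⇒∣p∣≢0 {p = p} x-blue

∣p[x]≔true∣ : ∀ (p : Subset n) x → lookup p x ≡ false → ∣ p [ x ]≔ true ∣ ≡ suc ∣ p ∣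
∣p[x]≔true∣ (false ∷ p) zero refl = refl
∣p[x]≔true∣ (false ∷ p) (suc x) x-white = ∣p[x]≔true∣ p x x-white
∣p[x]≔true∣ (true ∷ p) (suc x) x-white = cong suc (∣p[x]≔true∣ p x x-white)

white-after-update : ∀ (p : Subset n) {x y} → lookup (p [ x ]≔ true) y ≡ false → lookup p y ≡ false
white-after-update p {x} {y} y-white with y ≟ x
... | yes refl with trans (sym (lookup∘update y p true)) y-white
...   | ()
white-after-update p {x} {y} y-white | no y≢x = trans (sym (lookup∘update′ y≢x p true)) y-white

module Forcing {H : Graph n} {B B′ : Subset n} (f : Force H B B′) where

  forcer forced : Fin n
  forcer = proj₁ f
  forced = proj₁ (proj₂ f)

  forcer-blue : lookup B forcer ≡ true
  forcer-blue = let _ , _ , blue , _ = f in blue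

  forcer~forced : Adj H forcer forced
  forcer~forced = let _ , _ , _ , adj , _ = f in adj

  forced-white : lookup B forced ≡ false
  forced-white = let _ , _ , _ , _ , white , _ = f in white

  other-neighbours-blue : ∀ u → Adj H forcer u → u ≢ forced → lookup B u ≡ true
  other-neighbours-blue = let _ , _ , _ , _ , _ , others , _ = f in others

  recolouring : ∀ u → lookup B′ u ≡ (lookup B u ∨ isYes (u ≟ forced))
  recolouring = let _ , _ , _ , _ , _ , _ , eq = f in eq

  B′≡B[forced]≔true : B′ ≡ B [ forced ]≔ true
  B′≡B[forced]≔true = lookup-ext pointwise
    where
    pointwise : ∀ u → lookup B′ u ≡ lookup (B [ forced ]≔ true) u
    pointwise u with u ≟ forced | recolouring u
    ... | yes refl | eq = trans (trans eq (∨-zeroʳ _)) (sym (lookup∘update u B true))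
    ... | no u≢w | eq = trans (trans eq (∨-identityʳ _)) (sym (lookup∘update′ u≢w B true))

  force-∣∣ : ∣ B′ ∣ ≡ suc ∣ B ∣
  force-∣∣ = trans (cong ∣_∣ B′≡B[forced]≔true) (∣p[x]≔true∣ B forced forced-white)

  forced-blue : lookup B′ forced ≡ true
  forced-blue = subst (λ q → lookup q forced ≡ true) (sym B′≡B[forced]≔true) (lookup∘update forced B true)

  white-after-force : ∀ {x} → lookup B′ x ≡ false → lookup B x ≡ false
  white-after-force x-white =
    white-after-update B (subst (λ q → lookup q _ ≡ false) B′≡B[forced]≔true x-white)

  forcer-¬adj-white : ∀ {x} → lookup B′ x ≡ false → ¬ Adj H forcer x
  forcer-¬adj-white {x} x-white forcer~x with x ≟ forced
  ... | yes refl = blue≢white B′ forced-blue x-white refl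
  ... | no x≢w = blue≢white B (other-neighbours-blue x forcer~x x≢w) (white-after-force x-white) refl

zeroForcingSet-hasBlue : ∀ {H : Graph n} {B} → IsZeroForcingSet H B → Fin n → ∃ λ v → lookup B v ≡ true
zeroForcingSet-hasBlue (_ , ε , all-blue) x = x , all-blue x
zeroForcingSet-hasBlue (_ , (v , _ , v-blue , _) ◅ _ , _) _ = v , v-blue

module ComplementForcing (G : Graph n) {B B′ : Subset n} (f : Force (complement G) B B′) where

  open Forcing {H = complement G} {B} {B′} f public

  forcer-¬¬adj-white : ∀ {x} → lookup B′ x ≡ false → ¬ ¬ Adj G forcer x
  forcer-¬¬adj-white x-white ¬forcer~x =
    forcer-¬adj-white x-white (blue≢white B forcer-blue (white-after-force x-white) , ¬forcer~x)

-- A cycle with m = k has k + 3 vertices, so squares are the cycles with m = 1.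
square : ∀ (G : Graph n) {x y z t} → Unique (x ∷ y ∷ z ∷ t ∷ []) →
  Adj G x y → Adj G y z → Adj G z t → Adj G t x → Σ (Cycle G) λ C → m C ≡ 1
square G {x} {y} {z} {t} unique x~y y~z z~t t~x =
  record { m = 1 ; c = lookup vs ; inj = lookup-injective unique ; adj = adjacent } , refl
  where
  vs = x ∷ y ∷ z ∷ t ∷ []
  adjacent : ∀ i → Adj G (lookup vs i) (lookup vs (next i))
  adjacent zero = x~y
  adjacent (suc zero) = y~z
  adjacent (suc (suc zero)) = z~t
  adjacent (suc (suc (suc zero))) = t~x

sameCycle-vertex : ∀ {G : Graph n} (C D : Cycle G) → SameCycle C D → ∀ k → ∃ λ i → c C i ≡ c D k
sameCycle-vertex C D same k
  with Equivalence.from (same (c D k) (c D (next k))) (k , inj₁ (refl , refl))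
... | i , inj₁ (ci≡cDk , _) = i , ci≡cDk
... | i , inj₂ (_ , c[next-i]≡cDk) = next i , c[next-i]≡cDk

sameCycle⇒m≤ : ∀ {G : Graph n} (C D : Cycle G) → SameCycle C D → m D ≤ m C
sameCycle⇒m≤ C D same = ≮⇒≥ λ mC<mD →
  let i , j , i<j , same-vertex = pigeonhole (s≤s (s≤s (s≤s mC<mD))) (proj₁ ∘ vertex)
  in <⇒≢ i<j (inj D i j (trans (sym (proj₂ (vertex i)))
                               (trans (cong (c C) same-vertex) (proj₂ (vertex j)))))
  where vertex = sameCycle-vertex C D same

sameCycle⇒sameLength : ∀ {G : Graph n} (C D : Cycle G) → SameCycle C D → m C ≡ m D
sameCycle⇒sameLength C D same =
  ≤-antisym (sameCycle⇒m≤ D C (λ u v → ⇔.sym (same u v))) (sameCycle⇒m≤ C D same)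

unique-square⇒inducedC4 : ∀ {G : Graph n} → (∀ (C D : Cycle G) → SameCycle C D) →
  (C : Cycle G) → m C ≡ 1 → HasInducedC4 G
unique-square⇒inducedC4 {G = G} unique C@(record { m = 1 ; c = q ; inj = q-inj ; adj = q~ }) _ =
  q i₀ , q i₁ , q i₂ , q i₃ ,
  q≢ i₀ i₁ (λ ()) , q≢ i₀ i₂ (λ ()) , q≢ i₀ i₃ (λ ()) ,
  q≢ i₁ i₂ (λ ()) , q≢ i₁ i₃ (λ ()) , q≢ i₂ i₃ (λ ()) ,
  q~ i₀ , q~ i₁ , q~ i₂ , q~ i₃ ,
  no-chord₀₂ , no-chord₁₃
  where
  i₀ i₁ i₂ i₃ : Fin 4
  i₀ = zero
  i₁ = suc zero
  i₂ = suc (suc zero)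
  i₃ = suc (suc (suc zero))

  q≢ : ∀ i j → i ≢ j → q i ≢ q j
  q≢ i j i≢j = i≢j ∘ q-inj i j

  no-triangle : (T : Cycle G) → m T ≢ 0
  no-triangle T mT≡0 with trans (sameCycle⇒sameLength C T (unique C T)) mT≡0
  ... | ()

  no-chord₀₂ : ¬ Adj G (q i₀) (q i₂)
  no-chord₀₂ q₀~q₂ = no-triangle triangle refl
    where
    adjacent : ∀ i → Adj G (q (inject₁ i)) (q (inject₁ (next i)))
    adjacent zero = q~ i₀
    adjacent (suc zero) = q~ i₁
    adjacent (suc (suc zero)) = Graph.sym G q₀~q₂
    triangle = record { m = 0 ; c = q ∘ inject₁ ; inj = λ i j → inject₁-injective ∘ q-inj _ _
                      ; adj = adjacent }

  no-chord₁₃ : ¬ Adj G (q i₁) (q i₃)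
  no-chord₁₃ q₁~q₃ = no-triangle triangle refl
    where
    adjacent : ∀ i → Adj G (q (suc i)) (q (suc (next i)))
    adjacent zero = q~ i₁
    adjacent (suc zero) = q~ i₂
    adjacent (suc (suc zero)) = Graph.sym G q₁~q₃
    triangle = record { m = 0 ; c = q ∘ suc ; inj = λ i j → suc-injective ∘ q-inj _ _
                      ; adj = adjacent }

two-forces⇒¬¬square : ∀ (G : Graph n) {B B₁ B₂} →
  Force (complement G) B B₁ → Force (complement G) B₁ B₂ →
  ∀ {a b} → a ≢ b → lookup B₂ a ≡ false → lookup B₂ b ≡ false →
  ¬ ¬ (Σ (Cycle G) λ C → m C ≡ 1)
two-forces⇒¬¬square G {B} {B₁} {B₂} f₁ f₂ {a} {b} a≢b a-white₂ b-white₂ = do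
  u~a ← F₂.forcer-¬¬adj-white a-white₂
  u~b ← F₂.forcer-¬¬adj-white b-white₂
  v~a ← F₁.forcer-¬¬adj-white a-white₁
  v~b ← F₁.forcer-¬¬adj-white b-white₁
  pure (square G distinct u~a (Graph.sym G v~a) v~b (Graph.sym G u~b))
  where
  open RawMonad ¬¬-Monad
  module F₁ = ComplementForcing G {B} {B₁} f₁
  module F₂ = ComplementForcing G {B₁} {B₂} f₂
  u = F₂.forcer
  v = F₁.forcer
  a-white₁ = F₂.white-after-force a-white₂
  b-white₁ = F₂.white-after-force b-white₂

  u≢v : u ≢ v
  u≢v refl = F₁.forcer-¬¬adj-white F₂.forced-white (proj₂ F₂.forcer~forced)

  distinct : Unique (u ∷ a ∷ v ∷ b ∷ [])
  distinct =
    (blue≢white B₁ F₂.forcer-blue a-white₁ ∷ u≢v ∷ blue≢white B₁ F₂.forcer-blue b-white₁ ∷ []) ∷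
    ((blue≢white B F₁.forcer-blue (F₁.white-after-force a-white₁) ∘ sym) ∷ a≢b ∷ []) ∷
    (blue≢white B F₁.forcer-blue (F₁.white-after-force b-white₁) ∷ []) ∷
    [] ∷ []

complement-zeroForcingSet⇒¬¬square : ∀ (G : Graph n) {B} →
  IsZeroForcingSet (complement G) B → 4 + ∣ B ∣ ≤ n → ¬ ¬ (Σ (Cycle G) λ C → m C ≡ 1)
complement-zeroForcingSet⇒¬¬square G {B} (_ , ε , all-blue) 4+∣B∣≤n =
  contradiction all-blue (¬allBlue B (ℕ.≤-trans (s≤s (m≤n+m ∣ B ∣ 3)) 4+∣B∣≤n))
complement-zeroForcingSet⇒¬¬square {n} G {B} (F , f ◅ ε , all-blue) 4+∣B∣≤n =
  contradiction all-blue (¬allBlue F ∣F∣<n)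
  where
  open ℕ.≤-Reasoning
  ∣F∣<n : ∣ F ∣ < n
  ∣F∣<n = begin-strict
    ∣ F ∣      ≡⟨ Forcing.force-∣∣ {H = complement G} {B} {F} f ⟩
    1 + ∣ B ∣  <⟨ s≤s (s≤s (m≤n+m ∣ B ∣ 2)) ⟩
    4 + ∣ B ∣  ≤⟨ 4+∣B∣≤n ⟩
    n          ∎
complement-zeroForcingSet⇒¬¬square {n} G {B} (_ , _◅_ {j = B₁} f₁ (_◅_ {j = B₂} f₂ _) , _) 4+∣B∣≤n
  with ∃₂-white B₂ (subst (_≤ n) (cong (2 +_) (sym ∣B₂∣≡2+∣B∣)) 4+∣B∣≤n)
  where
  module F₁ = Forcing {H = complement G} {B} {B₁} f₁
  module F₂ = Forcing {H = complement G} {B₁} {B₂} f₂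
  ∣B₂∣≡2+∣B∣ : ∣ B₂ ∣ ≡ 2 + ∣ B ∣
  ∣B₂∣≡2+∣B∣ = trans F₂.force-∣∣ (cong suc F₁.force-∣∣)
... | a , b , a≢b , a-white , b-white = two-forces⇒¬¬square G {B} {B₁} {B₂} f₁ f₂ a≢b a-white b-white

-- Adjacency is undecidable, so the forcing argument only refutes the absence of a square; the
-- length of the unique cycle is decidable, so it can still be read off.
proposition3p8 : (n : ℕ) (G : Graph n) → Unicyclic G →
    ZeroForcingNumber (complement G) (n ∸ 4) → HasInducedC4 G
proposition3p8 n G (_ , C , unique) ((B , zfs , ∣B∣≡n∸4) , _) =
  unique-square⇒inducedC4 unique C
    (decidable-stable (m C ℕ.≟ 1)
      (¬¬-map length-of-C (complement-zeroForcingSet⇒¬¬square G zfs (≤-reflexive 4+∣B∣≡n))))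
  where
  length-of-C : Σ (Cycle G) (λ D → m D ≡ 1) → m C ≡ 1
  length-of-C (D , mD≡1) = trans (sameCycle⇒sameLength C D (unique C D)) mD≡1

  4≤n : 4 ≤ n
  4≤n = ≮⇒≥ λ n<4 → let _ , v-blue = zeroForcingSet-hasBlue {H = complement G} zfs (c C zero) in
    blue⇒∣p∣≢0 {p = B} v-blue (trans ∣B∣≡n∸4 (m≤n⇒m∸n≡0 (<⇒≤ n<4)))

  4+∣B∣≡n : 4 + ∣ B ∣ ≡ n
  4+∣B∣≡n = trans (cong (4 +_) ∣B∣≡n∸4) (m+[n∸m]≡n 4≤n)
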